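{- Let $T$ be a finite thread and $k\in\mathbb{N}$. Then there exists a meadow term $t_T$ over the signature $(0,1,+,\cdot,-,{}^{ -1})$ with variables among $x_0,\dots,x_k$ such that for all cancellation meadows $\mathcal{M}$ and all $m_0,\dots,m_k\in\mathcal{M}$: if $[\![T]\!]^k_{\mathcal{M}}(m_0,\dots,m_k)$ is defined, then $[\![T]\!]^k_{\mathcal{M}}(m_0,\dots,m_k)$ equals the value of $t_T$ in $\mathcal{M}$ under the assignment $x_i\mapsto m_i$ ($0\le i\le k$).
   Context: A meadow is a commutative ring with unit with a total unary operation $x\mapsto x^{ -1}$ satisfying $(x^{ -1})^{ -1}=x$ and $x\cdot(x\cdot x^{ -1})=x$. A cancellation meadow is a meadow additionally satisfying $x\neq0\rightarrow x\cdot x^{ -1}=1$. Variables: input $x_0,x_1,\dots$, auxiliary $a_0,a_1,\dots$, output $y$. Actions (for auxiliary $a,a'$, input $x$): assignments $a.\mathtt{cp}(x)$ ($a:=x$), $a.\mathtt{set{:}0}$, $a.\mathtt{set{:}1}$, $a.\mathtt{set{:}ai}$ ($a:=-a$), $a.\mathtt{set{:}mi}$ ($a:=a^{ -1}$), $a.\mathtt{set{:}a}(a')$ ($a:=a+a'$), $a.\mathtt{set{:}m}(a')$ ($a:=a\cdot a'$), $y.\mathtt{cp}(a)$ ($y:=a$), always replying $\mathtt{true}$; and the test $a.\mathtt{test{:}0}$, which changes nothing and replies $\mathtt{true}$ iff the value of $a$ is $0$. Finite threads are defined inductively: $\mathsf{S}$ (termination), $\mathsf{D}$ (deadlock), and $T_1\trianglelefteq\mathtt{a}\trianglerighteq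 T_2$ for an action $\mathtt{a}$ and finite threads $T_1,T_2$ (perform $\mathtt{a}$, continue as $T_1$ on reply $\mathtt{true}$, as $T_2$ on $\mathtt{false}$); $\mathtt{a}\circ T$ abbreviates $T\trianglelefteq\mathtt{a}\trianglerighteq T$, and assignments occur only in this prefix form. For a meadow $\mathcal{M}$ and a state $\alpha$ (map from variables to $\mathcal{M}$), running $T$ from $\alpha$: $\mathsf{S}$ terminates, $\mathsf{D}$ deadlocks, assignments update the state and continue, $a.\mathtt{test{:}0}$ continues left if $\alpha(a)=0$ and right otherwise. $[\![T]\!]^k_{\mathcal{M}}(m_0,\dots,m_k)$ is the value of $y$ if the run from the initial state ($x_i=m_i$ for $i\le k$, all other variables $0$) ends in $\mathsf{S}$, and undefined otherwise. -}

module Defs where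

open import Level using (Level; _⊔_; suc)
open import Algebra.Bundles using (CommutativeRing)
open import Data.Nat using (ℕ; _<?_; _≟_)
open import Data.Fin using (Fin; fromℕ<)
open import Relation.Nullary using (¬_; yes; no)
open import Relation.Binary.PropositionalEquality using (_≡_)
open import Data.Product using (Σ; _×_)

record Meadow (c ℓ : Level) : Set (Level.suc (c ⊔ ℓ)) where
  field
    commutativeRing : CommutativeRing c ℓ
  open CommutativeRing commutativeRing public
  field
    _⁻¹       : Carrier → Carrier
    ⁻¹-cong   : ∀ {x y} → x ≈ y → x ⁻¹ ≈ y ⁻¹
    ⁻¹-invol  : ∀ x → (x ⁻¹) ⁻¹ ≈ x
    ril       : ∀ x → x * (x * x ⁻¹) ≈ x

IsCancellation : ∀ {c ℓ} → Meadow c ℓ → Set (c ⊔ ℓ)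
IsCancellation M = ∀ x → ¬ (x ≈ 0#) → x * (x ⁻¹) ≈ 1#
  where open Meadow M

data Term (n : ℕ) : Set where
  var  : Fin n → Term n
  zer  : Term n
  one  : Term n
  _⊕_  : Term n → Term n → Term n
  _⊗_  : Term n → Term n → Term n
  neg  : Term n → Term n
  inv  : Term n → Term n

eval : ∀ {c ℓ n} (M : Meadow c ℓ) → (Fin n → Meadow.Carrier M) → Term n → Meadow.Carrier M
eval M ρ (var i)  = ρ i
eval M ρ zer      = Meadow.0# M
eval M ρ one      = Meadow.1# M
eval M ρ (t ⊕ u)  = Meadow._+_ M (eval M ρ t) (eval M ρ u)
eval M ρ (t ⊗ u)  = Meadow._*_ M (eval M ρ t) (eval M ρ u)
eval M ρ (neg t)  = Meadow.-_ M (eval M ρ t)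
eval M ρ (inv t)  = Meadow._⁻¹ M (eval M ρ t)

data Assign : Set where
  cp    : (a x : ℕ) → Assign
  set0  : (a : ℕ) → Assign
  set1  : (a : ℕ) → Assign
  setai : (a : ℕ) → Assign
  setmi : (a : ℕ) → Assign
  seta  : (a a' : ℕ) → Assign
  setm  : (a a' : ℕ) → Assign
  ycp   : (a : ℕ) → Assign

data Thread : Set where
  S    : Thread
  D    : Thread
  _∘_  : Assign → Thread → Thread
  _⊴_⊵_ : Thread → ℕ → Thread → Thread

module _ {c ℓ} (M : Meadow c ℓ) where
  open Meadow M

  record State : Set c where
    constructor st
    field
      xs : ℕ → Carrier
      as : ℕ → Carrier
      y  : Carrier

  update : (ℕ → Carrier) → ℕ → Carrier → (ℕ → Carrier)
  update f a v b with a ≟ b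
  ... | yes _ = v
  ... | no  _ = f b

  exec : Assign → State → State
  exec (cp a x)    (st xs as y) = st xs (update as a (xs x)) y
  exec (set0 a)    (st xs as y) = st xs (update as a 0#) y
  exec (set1 a)    (st xs as y) = st xs (update as a 1#) y
  exec (setai a)   (st xs as y) = st xs (update as a (- as a)) y
  exec (setmi a)   (st xs as y) = st xs (update as a (as a ⁻¹)) y
  exec (seta a a') (st xs as y) = st xs (update as a (as a + as a')) y
  exec (setm a a') (st xs as y) = st xs (update as a (as a * as a')) y
  exec (ycp a)     (st xs as y) = st xs as (as a)

  -- Runs T σ σ' : the run of T from σ ends in S with final state σ'.
  -- (A run reaching D has no derivation.)
  data Runs : Thread → State → State → Set (c ⊔ ℓ) where
    stop   : ∀ {σ} → Runs S σ σ
    assign : ∀ {u T σ σ'} → Runs T (exec u σ) σ' → Runs (u ∘ T) σ σ'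
    testT  : ∀ {T₁ a T₂ σ σ'} → State.as σ a ≈ 0# →
             Runs T₁ σ σ' → Runs (T₁ ⊴ a ⊵ T₂) σ σ'
    testF  : ∀ {T₁ a T₂ σ σ'} → ¬ (State.as σ a ≈ 0#) →
             Runs T₂ σ σ' → Runs (T₁ ⊴ a ⊵ T₂) σ σ'

  initial : (k : ℕ) → (Fin (ℕ.suc k) → Carrier) → State
  initial k m = st xs₀ (λ _ → 0#) 0#
    where
      xs₀ : ℕ → Carrier
      xs₀ i with i <? ℕ.suc k
      ... | yes i<k = m (fromℕ< i<k)
      ... | no  _   = 0#

  DefinedWithValue : Thread → (k : ℕ) → (Fin (ℕ.suc k) → Carrier) → Carrier → Set (c ⊔ ℓ)
  DefinedWithValue T k m v = Σ State (λ σ' → Runs T (initial k m) σ' × State.y σ' ≡ v)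

-- Thread execution is symbolically evaluated into meadow terms: assignments
-- rewrite the term stored in a variable, and a zero test on a variable
-- holding the term s becomes the arithmetic selection
--   t₁ · (1 − s·s⁻¹) + t₂ · (s·s⁻¹),
-- which in a cancellation meadow equals t₁ when s = 0 and t₂ otherwise,
-- because s·s⁻¹ is then 0 resp. 1.
module Submission where

open import Defs
open import Level using (Level)
open import Algebra.Bundles using (Ring)
open import Data.Nat using (ℕ; suc; _<?_; _≟_)
open import Data.Fin using (Fin; fromℕ<)
open import Data.Product using (Σ; _,_)
open import Relation.Nullary using (yes; no)
import Relation.Binary.PropositionalEquality as ≡
import Algebra.Properties.Ring as RingProperties
import Relation.Binary.Reasoning.Setoid as SetoidReasoning

module Selection {c ℓ} (R : Ring c ℓ) where
  open Ring R
  open RingProperties R using (-0#≈0#)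
  open SetoidReasoning setoid

  select : Carrier → Carrier → Carrier → Carrier
  select p u w = u * (1# + - p) + w * p

  select-0 : ∀ {p} u w → p ≈ 0# → select p u w ≈ u
  select-0 {p} u w p≈0 = begin
    u * (1# + - p) + w * p   ≈⟨ +-cong (*-cong refl (+-cong refl (-‿cong p≈0))) (*-cong refl p≈0) ⟩
    u * (1# + - 0#) + w * 0# ≈⟨ +-cong (*-cong refl (+-congˡ -0#≈0#)) (zeroʳ w) ⟩
    u * (1# + 0#) + 0#       ≈⟨ +-identityʳ _ ⟩
    u * (1# + 0#)            ≈⟨ *-congˡ (+-identityʳ 1#) ⟩
    u * 1#                   ≈⟨ *-identityʳ u ⟩
    u                        ∎

  select-1 : ∀ {p} u w → p ≈ 1# → select p u w ≈ w
  select-1 {p} u w p≈1 = begin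
    u * (1# + - p) + w * p   ≈⟨ +-cong (*-cong refl (+-cong refl (-‿cong p≈1))) (*-cong refl p≈1) ⟩
    u * (1# + - 1#) + w * 1# ≈⟨ +-cong (*-congˡ (-‿inverseʳ 1#)) (*-identityʳ w) ⟩
    u * 0# + w               ≈⟨ +-congʳ (zeroʳ u) ⟩
    0# + w                   ≈⟨ +-identityˡ w ⟩
    w                        ∎

setAt : ∀ {a} {A : Set a} → (ℕ → A) → ℕ → A → ℕ → A
setAt f a v b with a ≟ b
... | yes _ = v
... | no  _ = f b

record TermState (n : ℕ) : Set where
  constructor tst
  field
    xs : ℕ → Term n
    as : ℕ → Term n
    y  : Term n

execTerm : ∀ {n} → Assign → TermState n → TermState n
execTerm (cp a x)    (tst xs as y) = tst xs (setAt as a (xs x)) y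
execTerm (set0 a)    (tst xs as y) = tst xs (setAt as a zer) y
execTerm (set1 a)    (tst xs as y) = tst xs (setAt as a one) y
execTerm (setai a)   (tst xs as y) = tst xs (setAt as a (neg (as a))) y
execTerm (setmi a)   (tst xs as y) = tst xs (setAt as a (inv (as a))) y
execTerm (seta a a') (tst xs as y) = tst xs (setAt as a (as a ⊕ as a')) y
execTerm (setm a a') (tst xs as y) = tst xs (setAt as a (as a ⊗ as a')) y
execTerm (ycp a)     (tst xs as y) = tst xs as (as a)

ifZero : ∀ {n} → Term n → Term n → Term n → Term n
ifZero s t₁ t₂ = (t₁ ⊗ (one ⊕ neg (s ⊗ inv s))) ⊕ (t₂ ⊗ (s ⊗ inv s))

-- D has no run, so its term is arbitrary.
compile : ∀ {n} → Thread → TermState n → Term n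
compile S             σ = TermState.y σ
compile D             σ = zer
compile (u ∘ T)       σ = compile T (execTerm u σ)
compile (T₁ ⊴ a ⊵ T₂) σ = ifZero (TermState.as σ a) (compile T₁ σ) (compile T₂ σ)

initialTerm : (k : ℕ) → TermState (suc k)
initialTerm k = tst xs₀ (λ _ → zer) zer
  where
    xs₀ : ℕ → Term (suc k)
    xs₀ i with i <? suc k
    ... | yes i<k = var (fromℕ< i<k)
    ... | no  _   = zer

module Soundness {c ℓ} (M : Meadow c ℓ) {n : ℕ} (ρ : Fin n → Meadow.Carrier M) where
  open Meadow M
  open Selection ring

  ⟦_⟧ : Term n → Carrier
  ⟦_⟧ = eval M ρ

  record Denotes (τ : TermState n) (σ : State M) : Set ℓ where
    constructor denotes
    field
      xs : ∀ i → ⟦ TermState.xs τ i ⟧ ≈ State.xs σ i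
      as : ∀ i → ⟦ TermState.as τ i ⟧ ≈ State.as σ i
      y  : ⟦ TermState.y τ ⟧ ≈ State.y σ

  setAt-denotes : ∀ {f g} a {t v} → (∀ i → ⟦ f i ⟧ ≈ g i) → ⟦ t ⟧ ≈ v →
                  ∀ i → ⟦ setAt f a t i ⟧ ≈ update M g a v i
  setAt-denotes a f≈g t≈v i with a ≟ i
  ... | yes _ = t≈v
  ... | no  _ = f≈g i

  execTerm-denotes : ∀ u {τ σ} → Denotes τ σ → Denotes (execTerm u τ) (exec M u σ)
  execTerm-denotes (cp a x)    {tst _ _ _} {st _ _ _} (denotes xs as y) =
    denotes xs (setAt-denotes a as (xs x)) y
  execTerm-denotes (set0 a)    {tst _ _ _} {st _ _ _} (denotes xs as y) =
    denotes xs (setAt-denotes a as refl) y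
  execTerm-denotes (set1 a)    {tst _ _ _} {st _ _ _} (denotes xs as y) =
    denotes xs (setAt-denotes a as refl) y
  execTerm-denotes (setai a)   {tst _ _ _} {st _ _ _} (denotes xs as y) =
    denotes xs (setAt-denotes a as (-‿cong (as a))) y
  execTerm-denotes (setmi a)   {tst _ _ _} {st _ _ _} (denotes xs as y) =
    denotes xs (setAt-denotes a as (⁻¹-cong (as a))) y
  execTerm-denotes (seta a a') {tst _ _ _} {st _ _ _} (denotes xs as y) =
    denotes xs (setAt-denotes a as (+-cong (as a) (as a'))) y
  execTerm-denotes (setm a a') {tst _ _ _} {st _ _ _} (denotes xs as y) =
    denotes xs (setAt-denotes a as (*-cong (as a) (as a'))) y
  execTerm-denotes (ycp a)     {tst _ _ _} {st _ _ _} (denotes xs as y) =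
    denotes xs as (as a)

  compile-sound : IsCancellation M → ∀ {T σ σ'} → Runs M T σ σ' →
                  ∀ {τ} → Denotes τ σ → State.y σ' ≈ ⟦ compile T τ ⟧
  compile-sound canc stop τ≈σ = sym (Denotes.y τ≈σ)
  compile-sound canc (assign {u = u} R) τ≈σ =
    compile-sound canc R (execTerm-denotes u τ≈σ)
  compile-sound canc (testT {T₁} {a} {T₂} σa≈0 R) {τ} τ≈σ =
    trans (compile-sound canc R τ≈σ)
          (sym (select-0 ⟦ compile T₁ τ ⟧ ⟦ compile T₂ τ ⟧ (trans (*-congʳ s≈0) (zeroˡ _))))
    where
      s≈0 : ⟦ TermState.as τ a ⟧ ≈ 0#
      s≈0 = trans (Denotes.as τ≈σ a) σa≈0
  compile-sound canc (testF {T₁} {a} {T₂} σa≉0 R) {τ} τ≈σ =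
    trans (compile-sound canc R τ≈σ)
          (sym (select-1 ⟦ compile T₁ τ ⟧ ⟦ compile T₂ τ ⟧
                         (canc _ λ s≈0 → σa≉0 (trans (sym (Denotes.as τ≈σ a)) s≈0))))

initialTerm-denotes : ∀ {c ℓ} (M : Meadow c ℓ) k (m : Fin (suc k) → Meadow.Carrier M) →
                      Soundness.Denotes M m (initialTerm k) (initial M k m)
initialTerm-denotes M k m = Soundness.denotes xs (λ _ → Meadow.refl M) (Meadow.refl M)
  where
    xs : ∀ i → Meadow._≈_ M (eval M m (TermState.xs (initialTerm k) i))
                             (State.xs (initial M k m) i)
    xs i with i <? suc k
    ... | yes _ = Meadow.refl M
    ... | no  _ = Meadow.refl M

mainTheorem5 : (c ℓ : Level) (T : Thread) (k : ℕ) →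
    Σ (Term (suc k)) λ t →
      (M : Meadow c ℓ) → IsCancellation M →
      (m : Fin (suc k) → Meadow.Carrier M) (v : Meadow.Carrier M) →
      DefinedWithValue M T k m v → Meadow._≈_ M v (eval M m t)
mainTheorem5 c ℓ T k = compile T (initialTerm k) , λ where
  M canc m _ (_ , R , ≡.refl) →
    Soundness.compile-sound M m canc R (initialTerm-denotes M k m)
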